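{- Assume a graph $G=(V,E)$, $\lambda\in[0,1]$, and $\epsilon>0$. Let $\alpha$ be the score $q(\cdot,\cdot;\lambda)$ of the solution returned by \textsc{STC-ILP} and let $\alpha^*$ be the optimal score of \textsc{stc-den}. Then $\alpha\ge \alpha^*/(1+\epsilon)$.
   Context: Let $G=(V,E)$ be a finite simple undirected unweighted graph with $n=|V|$. For $U\subseteq V$, $E(U)$ is the set of edges with both endpoints in $U$. A labeling $L$ assigns each edge the label strong or weak. A labeling satisfies the strong triadic closure (STC) property in $(U,E(U))$ if for all distinct $x,y,z\in U$ with $(x,y),(y,z)\in E(U)$ both labeled strong, we have $(x,z)\in E$. Let $m_s(U,L)$, $m_w(U,L)$ be the numbers of strong and weak edges in $E(U)$; for nonempty $U$, $q(U,L;\lambda)=\frac{m_s(U,L)+\lambda m_w(U,L)}{|U|}$. Problem \textsc{stc-den}: find nonempty $U$ and $L$ satisfying STC in $(U,E(U))$ maximizing $q(U,L;\lambda)$. Problem $\textsc{stc-den}(\alpha)$: find $U\subseteq V$ (possibly empty) and $L$ satisfying STC in $(U,E(U))$ maximizing $m_s(U,L)+\lambda m_w(U,L)-\alpha|U|$ (solved exactly, e.g. by an integer linear program). Algorithm \textsc{STC-ILP} with parameter $\epsilon>0$: maintain an interval $(L,U)$ initialized to $L=0$, $U=\frac{n-1}{2}$; repeatedly take the midpoint $\beta$, solve $\textsc{stc-den}(\beta)$ exactly, and set $L=\beta$ if the returned vertex set is nonempty and $U=\beta$ otherwise; stop once $|U-L|\le\epsilon L$ and return the solution of $\textsc{stc-den}(L)$.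 -}

module Defs where

open import Data.Bool using (Bool; true; false; not; if_then_else_)
open import Data.Nat as ℕ using (ℕ; zero; suc; NonZero)
open import Data.Fin using (Fin; zero; suc; _<?_)
open import Data.Fin.Subset using (Subset; _∈_; ∣_∣; Nonempty; inside; outside)

open import Data.Vec.Base using (here; there)
open import Data.Fin.Subset.Properties using (_∈?_)
open import Data.Vec using (Vec; _∷_; [])
open import Data.List using (List; length; filter; allFin; cartesianProduct)
open import Data.Product using (Σ; ∃; _×_; _,_; proj₁; proj₂)
open import Data.Integer using (+_)
open import Data.Rational as ℚ using (ℚ; 0ℚ; 1ℚ; ½; _/_; _+_; _*_; _-_; _≤_)
open import Relation.Nullary using (¬_; Dec; yes; no)
open import Relation.Nullary.Decidable using (_×-dec_; ⌊_⌋)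
open import Relation.Binary.PropositionalEquality using (_≡_; _≢_)

record Graph (n : ℕ) : Set where
  field
    adj     : Fin n → Fin n → Bool
    symm    : ∀ i j → adj i j ≡ adj j i
    irrefl  : ∀ i → adj i i ≡ false

open Graph public

-- A labeling assigns a label to every unordered pair {i, j}; we read the
-- label of {i, j} (with i < j) as  lab i j , so no symmetry condition is needed.
Labeling : ℕ → Set
Labeling n = Fin n → Fin n → Bool

strong : ∀ {n} → Labeling n → Fin n → Fin n → Bool
strong L i j with i <? j
... | yes _ = L i j
... | no  _ = L j i

edgesIn : ∀ {n} → Graph n → Subset n → List (Fin n × Fin n)
edgesIn {n} G U =
  filter (λ e → (proj₁ e <? proj₂ e) ×-dec (proj₁ e ∈? U) ×-dec (proj₂ e ∈? U)
                 ×-dec (adj G (proj₁ e) (proj₂ e) Data.Bool.≟ true))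
         (cartesianProduct (allFin n) (allFin n))

mStrong : ∀ {n} → Graph n → Subset n → Labeling n → ℕ
mStrong G U L = length (filter (λ e → strong L (proj₁ e) (proj₂ e) Data.Bool.≟ true) (edgesIn G U))

mWeak : ∀ {n} → Graph n → Subset n → Labeling n → ℕ
mWeak G U L = length (filter (λ e → strong L (proj₁ e) (proj₂ e) Data.Bool.≟ false) (edgesIn G U))

toℚ : ℕ → ℚ
toℚ k = + k / 1

STC : ∀ {n} → Graph n → Subset n → Labeling n → Set
STC G U L = ∀ x y z → x ∈ U → y ∈ U → z ∈ U → x ≢ y → y ≢ z → x ≢ z →
  adj G x y ≡ true → adj G y z ≡ true →
  strong L x y ≡ true → strong L y z ≡ true → adj G x z ≡ true

Solution : ℕ → Set
Solution n = Subset n × Labeling n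

-- numerator m_s + w m_w  (w plays the role of λ)
weight : ∀ {n} → Graph n → ℚ → Solution n → ℚ
weight G w (U , L) = toℚ (mStrong G U L) + w * toℚ (mWeak G U L)

nonempty⇒nonZero : ∀ {n} (U : Subset n) → Nonempty U → NonZero ∣ U ∣
nonempty⇒nonZero (inside ∷ U) (zero , _) = _
nonempty⇒nonZero (inside ∷ U) (suc x , _) = _
nonempty⇒nonZero (outside ∷ U) (zero , ())
nonempty⇒nonZero (outside ∷ U) (suc x , there x∈U) = nonempty⇒nonZero U (x , x∈U)

score : ∀ {n} → Graph n → ℚ → (s : Solution n) → Nonempty (proj₁ s) → ℚ
score G w s ne = weight G w s * (+ 1 / ∣ proj₁ s ∣)
  where instance _ = nonempty⇒nonZero (proj₁ s) ne

IsOptimalScore : ∀ {n} → Graph n → ℚ → ℚ → Set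
IsOptimalScore G w α* =
  (Σ (Solution _) λ s → Σ (Nonempty (proj₁ s)) λ ne →
      STC G (proj₁ s) (proj₂ s) × score G w s ne ≡ α*)
  × (∀ (s : Solution _) (ne : Nonempty (proj₁ s)) →
      STC G (proj₁ s) (proj₂ s) → score G w s ne ≤ α*)

objective : ∀ {n} → Graph n → ℚ → ℚ → Solution n → ℚ
objective G w β s = weight G w s - β * toℚ ∣ proj₁ s ∣

OptimalFor : ∀ {n} → Graph n → ℚ → ℚ → Solution n → Set
OptimalFor G w β s = STC G (proj₁ s) (proj₂ s)
  × (∀ (s' : Solution _) → STC G (proj₁ s') (proj₂ s') →
       objective G w β s' ≤ objective G w β s)

Oracle : ℕ → Set
Oracle n = ℚ → Solution n

ExactOracle : ∀ {n} → Graph n → ℚ → Oracle n → Set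
ExactOracle G w o = ∀ β → OptimalFor G w β (o β)

Stop : ℚ → ℚ → ℚ → Set
Stop ε l u = ℚ.∣ u - l ∣ ≤ ε * l

midpoint : ℚ → ℚ → ℚ
midpoint l u = (l + u) * ½

-- Run o ε l u r : STC-ILP, started from the interval (l, u) and using the
-- exact solver o, terminates and returns r.
data Run {n : ℕ} (o : Oracle n) (ε : ℚ) : ℚ → ℚ → Solution n → Set where
  stop  : ∀ {l u} → Stop ε l u → Run o ε l u (o l)
  raise : ∀ {l u r} → ¬ Stop ε l u → Nonempty (proj₁ (o (midpoint l u))) →
          Run o ε (midpoint l u) u r → Run o ε l u r
  lower : ∀ {l u r} → ¬ Stop ε l u → ¬ Nonempty (proj₁ (o (midpoint l u))) →
          Run o ε l (midpoint l u) r → Run o ε l u r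

initialUpper : ℕ → ℚ
initialUpper n = (toℚ n - 1ℚ) * ½

{-# OPTIONS --safe #-}
-- The empty vertex set is feasible for stc-den(β) with objective 0. Hence an exact solution of
-- stc-den(β) with nonempty vertex set has density at least β, and if the exact solution is
-- empty then no STC solution has density above β. Hence along the bisection
-- the upper end u stays an upper bound on all STC densities; initially this holds because
-- |E(U)| ≤ |U|(|U| - 1)/2 and λ ≤ 1. When the search stops, the returned solution solves
-- stc-den(l) and is nonempty, so α* ≤ u ≤ (1 + ε) l ≤ (1 + ε) α.

module Submission where

open import Defs
open import Level using (Level; 0ℓ)
open import Data.Bool using (Bool; true; false)
import Data.Bool as Bool
open import Data.Nat as ℕ using (ℕ; zero; suc; NonZero; z≤n; s≤s)
import Data.Nat.Properties as ℕ
open import Data.Nat.ListAction using (sum)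
open import Data.Nat.Tactic.RingSolver using (solve-∀)
open import Data.Fin using (Fin; zero; suc; _<?_) renaming (_<_ to _<ᶠ_)
open import Data.Fin.Subset using (Subset; _∈_; ∣_∣; Nonempty; Empty; inside; outside; ⊥)
open import Data.Fin.Subset.Properties using (_∈?_; drop-there; ∉⊥; ∣⊥∣≡0; ∣p∣≤n; Empty-unique)
open import Data.Vec.Base using (here; there)
open import Data.Vec using (_∷_; [])
open import Data.List using (List; []; _∷_; _++_; length; filter; map; tabulate; allFin; cartesianProduct)
open import Data.List.Properties using (length-++; filter-++; filter-≐; filter-accept; filter-reject; filter-none; map-tabulate; tabulate-cong)
import Data.List.Relation.Unary.All as All
open import Data.List.Relation.Binary.Sublist.Propositional using (⊆-refl)
open import Data.List.Relation.Binary.Sublist.Propositional.Properties using (filter⁺; length-mono-≤)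
open import Data.Integer as ℤ using (+_)
import Data.Integer.Properties as ℤ
open import Data.Rational as ℚ using (ℚ; 0ℚ; 1ℚ; ½; _/_; _+_; _*_; _-_; _≤_; _<_; toℚᵘ)
import Data.Rational.Properties as ℚ
open import Data.Rational.Unnormalised as ℚᵘ using (mkℚᵘ; _≃_; *≡*; *≤*)
import Data.Rational.Unnormalised.Properties as ℚᵘ
open import Data.Rational.Solver using (module +-*-Solver)
open import Data.Product using (_×_; _,_; proj₁; proj₂)
open import Data.Sum using (inj₁; inj₂)
open import Function using (_∘_; id)
open import Relation.Nullary using (¬_; does; contradiction)
open import Relation.Nullary.Decidable using (_×-dec_)
open import Relation.Unary using (Pred; Decidable; _≐_)
open import Relation.Binary.PropositionalEquality

private
  variable
    a p q : Level
    A B : Set a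
    n : ℕ

module _ {P : Pred A p} (P? : Decidable P) where

  length-filter-map : (f : B → A) (xs : List B) →
                      length (filter P? (map f xs)) ≡ length (filter (P? ∘ f) xs)
  length-filter-map f []       = refl
  length-filter-map f (x ∷ xs) with does (P? (f x))
  ... | true  = cong suc (length-filter-map f xs)
  ... | false = length-filter-map f xs

module _ {P : Pred (A × B) p} (P? : Decidable P) where

  length-filter-cartesianProduct : (xs : List A) (ys : List B) →
    length (filter P? (cartesianProduct xs ys)) ≡
    sum (map (λ x → length (filter (λ y → P? (x , y)) ys)) xs)
  length-filter-cartesianProduct []       ys = refl
  length-filter-cartesianProduct (x ∷ xs) ys = begin
    length (filter P? (map (x ,_) ys ++ cartesianProduct xs ys))
      ≡⟨ cong length (filter-++ P? (map (x ,_) ys) _) ⟩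
    length (filter P? (map (x ,_) ys) ++ filter P? (cartesianProduct xs ys))
      ≡⟨ length-++ (filter P? (map (x ,_) ys)) ⟩
    length (filter P? (map (x ,_) ys)) ℕ.+ length (filter P? (cartesianProduct xs ys))
      ≡⟨ cong₂ ℕ._+_ (length-filter-map P? (x ,_) ys) (length-filter-cartesianProduct xs ys) ⟩
    _ ∎
    where open ≡-Reasoning

length-filter-true+false : (f : A → Bool) (xs : List A) →
  length (filter (λ x → f x Bool.≟ true) xs) ℕ.+ length (filter (λ x → f x Bool.≟ false) xs) ≡ length xs
length-filter-true+false f []       = refl
length-filter-true+false f (x ∷ xs) with f x
... | true  = cong suc (length-filter-true+false f xs)
... | false = trans (ℕ.+-suc _ _) (cong suc (length-filter-true+false f xs))

countFin : {P : Pred (Fin n) p} → Decidable P → ℕ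
countFin {n} P? = length (filter P? (allFin n))

module _ {P : Pred (Fin n) p} (P? : Decidable P) where

  countFin-cong : {Q : Pred (Fin n) q} (Q? : Decidable Q) → P ≐ Q → countFin P? ≡ countFin Q?
  countFin-cong Q? P≐Q = cong length (filter-≐ P? Q? P≐Q (allFin n))

  countFin-none : (∀ i → ¬ P i) → countFin P? ≡ 0
  countFin-none ¬P = cong length (filter-none P? (All.universal ¬P (allFin n)))

module _ {P : Pred (Fin (suc n)) p} (P? : Decidable P) where

  private
    countFin-tail : length (filter P? (tabulate suc)) ≡ countFin (P? ∘ suc)
    countFin-tail = trans (cong (length ∘ filter P?) (sym (map-tabulate id suc)))
                          (length-filter-map P? suc (allFin n))

  countFin-accept : P zero → countFin P? ≡ suc (countFin (P? ∘ suc))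
  countFin-accept P0 = trans (cong length (filter-accept P? P0)) (cong suc countFin-tail)

  countFin-reject : ¬ P zero → countFin P? ≡ countFin (P? ∘ suc)
  countFin-reject ¬P0 = trans (cong length (filter-reject P? ¬P0)) countFin-tail

countFin-there : (s : Bool) (U : Subset n) → countFin ((_∈? s ∷ U) ∘ suc) ≡ countFin (_∈? U)
countFin-there s U = countFin-cong ((_∈? s ∷ U) ∘ suc) (_∈? U) (drop-there , there)

∣∣≡countFin : (U : Subset n) → ∣ U ∣ ≡ countFin (_∈? U)
∣∣≡countFin []            = refl
∣∣≡countFin (inside ∷ U)  = begin
  suc ∣ U ∣                                 ≡⟨ cong suc (∣∣≡countFin U) ⟩
  suc (countFin (_∈? U))                    ≡⟨ cong suc (countFin-there inside U) ⟨
  suc (countFin ((_∈? inside ∷ U) ∘ suc))   ≡⟨ countFin-accept (_∈? inside ∷ U) here ⟨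
  countFin (_∈? inside ∷ U)                 ∎
  where open ≡-Reasoning
∣∣≡countFin (outside ∷ U) = begin
  ∣ U ∣                                     ≡⟨ ∣∣≡countFin U ⟩
  countFin (_∈? U)                          ≡⟨ countFin-there outside U ⟨
  countFin ((_∈? outside ∷ U) ∘ suc)        ≡⟨ countFin-reject (_∈? outside ∷ U) (λ ()) ⟨
  countFin (_∈? outside ∷ U)                ∎
  where open ≡-Reasoning

IncreasingPairIn : Subset n → Pred (Fin n × Fin n) 0ℓ
IncreasingPairIn U e = proj₁ e <ᶠ proj₂ e × proj₁ e ∈ U × proj₂ e ∈ U

increasingPairIn? : (U : Subset n) → Decidable (IncreasingPairIn U)
increasingPairIn? U e = (proj₁ e <? proj₂ e) ×-dec (proj₁ e ∈? U) ×-dec (proj₂ e ∈? U)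

pairsIn : Subset n → ℕ
pairsIn {n} U = length (filter (increasingPairIn? U) (cartesianProduct (allFin n) (allFin n)))

pairsFrom : Subset n → Fin n → ℕ
pairsFrom U i = countFin (λ j → increasingPairIn? U (i , j))

pairsIn≡sum-pairsFrom : (U : Subset n) → pairsIn U ≡ sum (tabulate (pairsFrom U))
pairsIn≡sum-pairsFrom {n} U =
  trans (length-filter-cartesianProduct (increasingPairIn? U) (allFin n) (allFin n))
        (cong sum (map-tabulate id (pairsFrom U)))

pairsFrom-suc : (s : Bool) (U : Subset n) (i : Fin n) → pairsFrom (s ∷ U) (suc i) ≡ pairsFrom U i
pairsFrom-suc s U i = trans
  (countFin-reject (λ j → increasingPairIn? (s ∷ U) (suc i , j)) λ { (() , _) })
  (countFin-cong (λ j → increasingPairIn? (s ∷ U) (suc i , suc j)) (λ j → increasingPairIn? U (i , j))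
                 ( (λ { (s≤s i<j , i∈ , j∈) → i<j , drop-there i∈ , drop-there j∈ })
                 , (λ { (i<j , i∈ , j∈) → s≤s i<j , there i∈ , there j∈ })))

pairsFrom-inside-zero : (U : Subset n) → pairsFrom (inside ∷ U) zero ≡ ∣ U ∣
pairsFrom-inside-zero U = begin
  pairsFrom (inside ∷ U) zero
    ≡⟨ countFin-reject (λ j → increasingPairIn? (inside ∷ U) (zero , j)) (λ { (() , _) }) ⟩
  countFin (λ j → increasingPairIn? (inside ∷ U) (zero , suc j))
    ≡⟨ countFin-cong (λ j → increasingPairIn? (inside ∷ U) (zero , suc j)) (_∈? U)
                     ((λ { (_ , _ , j∈) → drop-there j∈ }) , λ j∈ → s≤s z≤n , here , there j∈) ⟩
  countFin (_∈? U)
    ≡⟨ ∣∣≡countFin U ⟨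
  ∣ U ∣ ∎
  where open ≡-Reasoning

pairsFrom-outside-zero : (U : Subset n) → pairsFrom (outside ∷ U) zero ≡ 0
pairsFrom-outside-zero U =
  countFin-none (λ j → increasingPairIn? (outside ∷ U) (zero , j)) λ { _ (_ , () , _) }

pairsIn-∷ : (s : Bool) (U : Subset n) → pairsIn (s ∷ U) ≡ pairsFrom (s ∷ U) zero ℕ.+ pairsIn U
pairsIn-∷ s U = begin
  pairsIn (s ∷ U)
    ≡⟨ pairsIn≡sum-pairsFrom (s ∷ U) ⟩
  pairsFrom (s ∷ U) zero ℕ.+ sum (tabulate (pairsFrom (s ∷ U) ∘ suc))
    ≡⟨ cong (λ rest → pairsFrom (s ∷ U) zero ℕ.+ sum rest) (tabulate-cong (pairsFrom-suc s U)) ⟩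
  pairsFrom (s ∷ U) zero ℕ.+ sum (tabulate (pairsFrom U))
    ≡⟨ cong (pairsFrom (s ∷ U) zero ℕ.+_) (pairsIn≡sum-pairsFrom U) ⟨
  pairsFrom (s ∷ U) zero ℕ.+ pairsIn U
    ∎
  where open ≡-Reasoning

pairsIn-inside : (U : Subset n) → pairsIn (inside ∷ U) ≡ ∣ U ∣ ℕ.+ pairsIn U
pairsIn-inside U = trans (pairsIn-∷ inside U) (cong (ℕ._+ pairsIn U) (pairsFrom-inside-zero U))

pairsIn-outside : (U : Subset n) → pairsIn (outside ∷ U) ≡ pairsIn U
pairsIn-outside U = trans (pairsIn-∷ outside U) (cong (ℕ._+ pairsIn U) (pairsFrom-outside-zero U))

pairsIn-square : (U : Subset n) → 2 ℕ.* pairsIn U ℕ.+ ∣ U ∣ ≡ ∣ U ∣ ℕ.* ∣ U ∣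
pairsIn-square []            = refl
pairsIn-square (inside ∷ U)  = begin
  2 ℕ.* pairsIn (inside ∷ U) ℕ.+ suc ∣ U ∣     ≡⟨ cong (λ m → 2 ℕ.* m ℕ.+ suc ∣ U ∣) (pairsIn-inside U) ⟩
  2 ℕ.* (∣ U ∣ ℕ.+ pairsIn U) ℕ.+ suc ∣ U ∣    ≡⟨ regroup ∣ U ∣ (pairsIn U) ⟩
  (2 ℕ.* pairsIn U ℕ.+ ∣ U ∣) ℕ.+ suc (2 ℕ.* ∣ U ∣)  ≡⟨ cong (ℕ._+ suc (2 ℕ.* ∣ U ∣)) (pairsIn-square U) ⟩
  ∣ U ∣ ℕ.* ∣ U ∣ ℕ.+ suc (2 ℕ.* ∣ U ∣)        ≡⟨ square-suc ∣ U ∣ ⟩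
  suc ∣ U ∣ ℕ.* suc ∣ U ∣                      ∎
  where
  open ≡-Reasoning
  regroup : ∀ k m → 2 ℕ.* (k ℕ.+ m) ℕ.+ suc k ≡ (2 ℕ.* m ℕ.+ k) ℕ.+ suc (2 ℕ.* k)
  regroup = solve-∀
  square-suc : ∀ k → k ℕ.* k ℕ.+ suc (2 ℕ.* k) ≡ suc k ℕ.* suc k
  square-suc = solve-∀
pairsIn-square (outside ∷ U) = trans (cong (λ m → 2 ℕ.* m ℕ.+ ∣ U ∣) (pairsIn-outside U)) (pairsIn-square U)

length-edgesIn≤pairsIn : (G : Graph n) (U : Subset n) → length (edgesIn G U) ℕ.≤ pairsIn U
length-edgesIn≤pairsIn {n} G U = length-mono-≤ (filter⁺ _ (increasingPairIn? U)
  (λ { refl (i<j , i∈ , j∈ , _) → i<j , i∈ , j∈ }) (⊆-refl {x = cartesianProduct (allFin n) (allFin n)}))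

edgesIn-density : (G : Graph n) (U : Subset n) → 2 ℕ.* length (edgesIn G U) ℕ.+ ∣ U ∣ ℕ.≤ n ℕ.* ∣ U ∣
edgesIn-density {n} G U = begin
  2 ℕ.* length (edgesIn G U) ℕ.+ ∣ U ∣  ≤⟨ ℕ.+-monoˡ-≤ ∣ U ∣ (ℕ.*-monoʳ-≤ 2 (length-edgesIn≤pairsIn G U)) ⟩
  2 ℕ.* pairsIn U ℕ.+ ∣ U ∣             ≡⟨ pairsIn-square U ⟩
  ∣ U ∣ ℕ.* ∣ U ∣                       ≤⟨ ℕ.*-monoˡ-≤ ∣ U ∣ (∣p∣≤n U) ⟩
  n ℕ.* ∣ U ∣                           ∎
  where open ℕ.≤-Reasoning

edgesIn-⊥ : (G : Graph n) → edgesIn G ⊥ ≡ []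
edgesIn-⊥ {n} G = filter-none _ (All.universal (λ { _ (_ , i∈⊥ , _) → ∉⊥ i∈⊥ }) (cartesianProduct (allFin n) (allFin n)))

mStrong+mWeak : (G : Graph n) (U : Subset n) (L : Labeling n) →
                mStrong G U L ℕ.+ mWeak G U L ≡ length (edgesIn G U)
mStrong+mWeak G U L = length-filter-true+false (λ e → strong L (proj₁ e) (proj₂ e)) (edgesIn G U)

toℚᵘ-toℚ : (k : ℕ) → toℚᵘ (toℚ k) ≃ mkℚᵘ (+ k) 0
toℚᵘ-toℚ k = ℚ.toℚᵘ-fromℚᵘ (mkℚᵘ (+ k) 0)

toℚ-+ : (j k : ℕ) → toℚ (j ℕ.+ k) ≡ toℚ j + toℚ k
toℚ-+ j k = ℚ.toℚᵘ-injective (begin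
  toℚᵘ (toℚ (j ℕ.+ k))              ≈⟨ toℚᵘ-toℚ (j ℕ.+ k) ⟩
  mkℚᵘ (+ (j ℕ.+ k)) 0              ≈⟨ *≡* (cong (ℤ._* + 1) (trans (ℤ.pos-+ j k)
                                         (sym (cong₂ ℤ._+_ (ℤ.*-identityʳ (+ j)) (ℤ.*-identityʳ (+ k)))))) ⟩
  mkℚᵘ (+ j) 0 ℚᵘ.+ mkℚᵘ (+ k) 0    ≈⟨ ℚᵘ.+-cong (toℚᵘ-toℚ j) (toℚᵘ-toℚ k) ⟨
  toℚᵘ (toℚ j) ℚᵘ.+ toℚᵘ (toℚ k)    ≈⟨ ℚ.toℚᵘ-homo-+ (toℚ j) (toℚ k) ⟨
  toℚᵘ (toℚ j + toℚ k)              ∎)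
  where open ℚᵘ.≃-Reasoning

toℚ-* : (j k : ℕ) → toℚ (j ℕ.* k) ≡ toℚ j * toℚ k
toℚ-* j k = ℚ.toℚᵘ-injective (begin
  toℚᵘ (toℚ (j ℕ.* k))              ≈⟨ toℚᵘ-toℚ (j ℕ.* k) ⟩
  mkℚᵘ (+ (j ℕ.* k)) 0              ≈⟨ *≡* (cong (ℤ._* + 1) (ℤ.pos-* j k)) ⟩
  mkℚᵘ (+ j) 0 ℚᵘ.* mkℚᵘ (+ k) 0    ≈⟨ ℚᵘ.*-cong (toℚᵘ-toℚ j) (toℚᵘ-toℚ k) ⟨
  toℚᵘ (toℚ j) ℚᵘ.* toℚᵘ (toℚ k)    ≈⟨ ℚ.toℚᵘ-homo-* (toℚ j) (toℚ k) ⟨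
  toℚᵘ (toℚ j * toℚ k)              ∎)
  where open ℚᵘ.≃-Reasoning

toℚ-mono-≤ : {j k : ℕ} → j ℕ.≤ k → toℚ j ≤ toℚ k
toℚ-mono-≤ {j} {k} j≤k = ℚ.toℚᵘ-cancel-≤ (begin
  toℚᵘ (toℚ j)   ≃⟨ toℚᵘ-toℚ j ⟩
  mkℚᵘ (+ j) 0   ≤⟨ *≤* (ℤ.*-monoʳ-≤-nonNeg (+ 1) (ℤ.+≤+ j≤k)) ⟩
  mkℚᵘ (+ k) 0   ≃⟨ toℚᵘ-toℚ k ⟨
  toℚᵘ (toℚ k)   ∎)
  where open ℚᵘ.≤-Reasoning

toℚ-nonNeg : (k : ℕ) → 0ℚ ≤ toℚ k
toℚ-nonNeg k = toℚ-mono-≤ {0} {k} z≤n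

toℚ-*-1/ : (k : ℕ) .{{_ : NonZero k}} → toℚ k * (+ 1 / k) ≡ 1ℚ
toℚ-*-1/ (suc k) = ℚ.toℚᵘ-injective (begin
  toℚᵘ (toℚ (suc k) * (+ 1 / suc k))          ≈⟨ ℚ.toℚᵘ-homo-* (toℚ (suc k)) (+ 1 / suc k) ⟩
  toℚᵘ (toℚ (suc k)) ℚᵘ.* toℚᵘ (+ 1 / suc k)  ≈⟨ ℚᵘ.*-cong (toℚᵘ-toℚ (suc k)) (ℚ.toℚᵘ-fromℚᵘ (mkℚᵘ (+ 1) k)) ⟩
  mkℚᵘ (+ suc k) 0 ℚᵘ.* mkℚᵘ (+ 1) k          ≈⟨ ℚᵘ.*-inverseʳ (mkℚᵘ (+ suc k) 0) ⟩
  ℚᵘ.1ℚᵘ                                      ∎)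
  where open ℚᵘ.≃-Reasoning

1/-nonNeg : (k : ℕ) .{{_ : NonZero k}} → ℚ.NonNegative (+ 1 / k)
1/-nonNeg k = ℚ.normalize-nonNeg 1 k

p≤q*k⇒p*1/k≤q : {p q : ℚ} (k : ℕ) .{{_ : NonZero k}} → p ≤ q * toℚ k → p * (+ 1 / k) ≤ q
p≤q*k⇒p*1/k≤q {p} {q} k p≤qk = begin
  p * (+ 1 / k)               ≤⟨ ℚ.*-monoʳ-≤-nonNeg (+ 1 / k) {{1/-nonNeg k}} p≤qk ⟩
  q * toℚ k * (+ 1 / k)       ≡⟨ ℚ.*-assoc q (toℚ k) (+ 1 / k) ⟩
  q * (toℚ k * (+ 1 / k))     ≡⟨ cong (q *_) (toℚ-*-1/ k) ⟩
  q * 1ℚ                      ≡⟨ ℚ.*-identityʳ q ⟩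
  q                           ∎
  where open ℚ.≤-Reasoning

q*k≤p⇒q≤p*1/k : {p q : ℚ} (k : ℕ) .{{_ : NonZero k}} → q * toℚ k ≤ p → q ≤ p * (+ 1 / k)
q*k≤p⇒q≤p*1/k {p} {q} k qk≤p = begin
  q                           ≡⟨ ℚ.*-identityʳ q ⟨
  q * 1ℚ                      ≡⟨ cong (q *_) (toℚ-*-1/ k) ⟨
  q * (toℚ k * (+ 1 / k))     ≡⟨ ℚ.*-assoc q (toℚ k) (+ 1 / k) ⟨
  q * toℚ k * (+ 1 / k)       ≤⟨ ℚ.*-monoʳ-≤-nonNeg (+ 1 / k) {{1/-nonNeg k}} qk≤p ⟩
  p * (+ 1 / k)               ∎
  where open ℚ.≤-Reasoning

p-q≤0⇒p≤q : {p q : ℚ} → p - q ≤ 0ℚ → p ≤ q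
p-q≤0⇒p≤q {p} {q} p-q≤0 = begin
  p            ≡⟨ solve 2 (λ p q → p := (p :- q) :+ q) refl p q ⟩
  (p - q) + q  ≤⟨ ℚ.+-monoˡ-≤ q p-q≤0 ⟩
  0ℚ + q       ≡⟨ ℚ.+-identityˡ q ⟩
  q            ∎
  where open ℚ.≤-Reasoning; open +-*-Solver

0≤p-q⇒q≤p : {p q : ℚ} → 0ℚ ≤ p - q → q ≤ p
0≤p-q⇒q≤p {p} {q} 0≤p-q = begin
  q            ≡⟨ ℚ.+-identityˡ q ⟨
  0ℚ + q       ≤⟨ ℚ.+-monoˡ-≤ q 0≤p-q ⟩
  (p - q) + q  ≡⟨ solve 2 (λ p q → (p :- q) :+ q := p) refl p q ⟩
  p            ∎
  where open ℚ.≤-Reasoning; open +-*-Solver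

p≤∣p∣ : (p : ℚ) → p ≤ ℚ.∣ p ∣
p≤∣p∣ p with ℚ.≤-total 0ℚ p
... | inj₁ 0≤p = ℚ.≤-reflexive (sym (ℚ.0≤p⇒∣p∣≡p 0≤p))
... | inj₂ p≤0 = ℚ.≤-trans p≤0 (ℚ.0≤∣p∣ p)

2m+k≤nk⇒m≤initialUpper*k : {m k : ℕ} → 2 ℕ.* m ℕ.+ k ℕ.≤ n ℕ.* k → toℚ m ≤ initialUpper n * toℚ k
2m+k≤nk⇒m≤initialUpper*k {n} {m} {k} 2m+k≤nk = begin
  toℚ m                                  ≡⟨ solve 2 (λ m k → m := ((con (toℚ 2) :* m :+ k) :- k) :* con ½)
                                                    refl (toℚ m) (toℚ k) ⟩
  ((toℚ 2 * toℚ m + toℚ k) - toℚ k) * ½  ≤⟨ ℚ.*-monoʳ-≤-nonNeg ½ (ℚ.+-monoˡ-≤ (ℚ.- toℚ k) cast) ⟩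
  ((toℚ n * toℚ k) - toℚ k) * ½          ≡⟨ solve 3 (λ n k h → ((n :* k) :- k) :* h := ((n :- con 1ℚ) :* h) :* k)
                                                    refl (toℚ n) (toℚ k) ½ ⟩
  initialUpper n * toℚ k                 ∎
  where
  open ℚ.≤-Reasoning
  open +-*-Solver
  cast : toℚ 2 * toℚ m + toℚ k ≤ toℚ n * toℚ k
  cast = subst₂ _≤_ (trans (toℚ-+ (2 ℕ.* m) k) (cong (_+ toℚ k) (toℚ-* 2 m))) (toℚ-* n k) (toℚ-mono-≤ 2m+k≤nk)

weight≤length-edgesIn : (G : Graph n) {w : ℚ} → w ≤ 1ℚ → (U : Subset n) (L : Labeling n) →
                        weight G w (U , L) ≤ toℚ (length (edgesIn G U))
weight≤length-edgesIn G {w} w≤1 U L = begin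
  toℚ ms + w * toℚ mw   ≤⟨ ℚ.+-monoʳ-≤ (toℚ ms) (ℚ.*-monoʳ-≤-nonNeg (toℚ mw) {{ℚ.nonNegative (toℚ-nonNeg mw)}} w≤1) ⟩
  toℚ ms + 1ℚ * toℚ mw  ≡⟨ cong (_+_ (toℚ ms)) (ℚ.*-identityˡ (toℚ mw)) ⟩
  toℚ ms + toℚ mw       ≡⟨ toℚ-+ ms mw ⟨
  toℚ (ms ℕ.+ mw)       ≡⟨ cong toℚ (mStrong+mWeak G U L) ⟩
  toℚ (length (edgesIn G U)) ∎
  where
  open ℚ.≤-Reasoning
  ms = mStrong G U L
  mw = mWeak G U L

score≤initialUpper : (G : Graph n) {w : ℚ} → w ≤ 1ℚ →
                     (s : Solution n) (ne : Nonempty (proj₁ s)) → score G w s ne ≤ initialUpper n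
score≤initialUpper {n} G {w} w≤1 (U , L) ne =
  p≤q*k⇒p*1/k≤q ∣ U ∣ {{nonempty⇒nonZero U ne}} (begin
    weight G w (U , L)           ≤⟨ weight≤length-edgesIn G w≤1 U L ⟩
    toℚ (length (edgesIn G U))   ≤⟨ 2m+k≤nk⇒m≤initialUpper*k {n} {length (edgesIn G U)} {∣ U ∣} (edgesIn-density G U) ⟩
    initialUpper n * toℚ ∣ U ∣   ∎)
  where open ℚ.≤-Reasoning

objective-⊥ : (G : Graph n) (w β : ℚ) (L : Labeling n) → objective G w β (⊥ , L) ≡ 0ℚ
objective-⊥ {n} G w β L = begin
  (toℚ (mStrong G ⊥ L) + w * toℚ (mWeak G ⊥ L)) - β * toℚ ∣ ⊥ {n = n} ∣
    ≡⟨ cong₂ (λ ms mw → (toℚ ms + w * toℚ mw) - β * toℚ ∣ ⊥ {n = n} ∣)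
             (ℕ.m+n≡0⇒m≡0 (mStrong G ⊥ L) no-edges) (ℕ.m+n≡0⇒n≡0 (mStrong G ⊥ L) no-edges) ⟩
  (0ℚ + w * 0ℚ) - β * toℚ ∣ ⊥ {n = n} ∣
    ≡⟨ cong (λ k → (0ℚ + w * 0ℚ) - β * toℚ k) (∣⊥∣≡0 n) ⟩
  (0ℚ + w * 0ℚ) - β * 0ℚ
    ≡⟨ solve 2 (λ w β → (con 0ℚ :+ w :* con 0ℚ) :- β :* con 0ℚ := con 0ℚ) refl w β ⟩
  0ℚ ∎
  where
  open ≡-Reasoning
  open +-*-Solver
  no-edges : mStrong G ⊥ L ℕ.+ mWeak G ⊥ L ≡ 0
  no-edges = trans (mStrong+mWeak G ⊥ L) (cong length (edgesIn-⊥ G))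

objective-Empty : (G : Graph n) (w β : ℚ) {U : Subset n} → Empty U → (L : Labeling n) →
                  objective G w β (U , L) ≡ 0ℚ
objective-Empty G w β U-empty L =
  subst (λ V → objective G w β (V , L) ≡ 0ℚ) (sym (Empty-unique U-empty)) (objective-⊥ G w β L)

STC-⊥ : (G : Graph n) (L : Labeling n) → STC G ⊥ L
STC-⊥ G L x y z x∈⊥ = contradiction x∈⊥ ∉⊥

ScoreUpperBound : Graph n → ℚ → ℚ → Set
ScoreUpperBound {n} G w u =
  (s : Solution n) (ne : Nonempty (proj₁ s)) → STC G (proj₁ s) (proj₂ s) → score G w s ne ≤ u

module _ (G : Graph n) (w β : ℚ) where

  optimalFor⇒≤score : (s : Solution n) → OptimalFor G w β s →
                      (ne : Nonempty (proj₁ s)) → β ≤ score G w s ne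
  optimalFor⇒≤score (U , L) (_ , optimal) ne =
    q*k≤p⇒q≤p*1/k ∣ U ∣ {{nonempty⇒nonZero U ne}}
      (0≤p-q⇒q≤p {weight G w (U , L)} {β * toℚ ∣ U ∣}
        (subst (_≤ objective G w β (U , L)) (objective-⊥ G w β L) (optimal (⊥ , L) (STC-⊥ G L))))

  optimalFor-Empty⇒ScoreUpperBound : (s : Solution n) → OptimalFor G w β s →
                                     Empty (proj₁ s) → ScoreUpperBound G w β
  optimalFor-Empty⇒ScoreUpperBound (U , L) (_ , optimal) U-empty (U′ , L′) ne stc =
    p≤q*k⇒p*1/k≤q ∣ U′ ∣ {{nonempty⇒nonZero U′ ne}}
      (p-q≤0⇒p≤q {weight G w (U′ , L′)} {β * toℚ ∣ U′ ∣}
        (subst (objective G w β (U′ , L′) ≤_) (objective-Empty G w β U-empty L) (optimal (U′ , L′) stc)))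

Stop⇒u≤[1+ε]l : {ε l u : ℚ} → Stop ε l u → u ≤ (1ℚ + ε) * l
Stop⇒u≤[1+ε]l {ε} {l} {u} stopped = begin
  u              ≡⟨ solve 2 (λ u l → u := (u :- l) :+ l) refl u l ⟩
  (u - l) + l    ≤⟨ ℚ.+-monoˡ-≤ l (ℚ.≤-trans (p≤∣p∣ (u - l)) stopped) ⟩
  ε * l + l      ≡⟨ solve 2 (λ ε l → ε :* l :+ l := (con 1ℚ :+ ε) :* l) refl ε l ⟩
  (1ℚ + ε) * l   ∎
  where open ℚ.≤-Reasoning; open +-*-Solver

module _ (G : Graph n) (w : ℚ) {ε : ℚ} {o : Oracle n} (exact : ExactOracle G w o) (0≤1+ε : 0ℚ ≤ 1ℚ + ε) where

  Run⇒ScoreUpperBound : {l u : ℚ} {r : Solution n} → Run o ε l u r → ScoreUpperBound G w u →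
                        (ne : Nonempty (proj₁ r)) → ScoreUpperBound G w ((1ℚ + ε) * score G w r ne)
  Run⇒ScoreUpperBound {l} {u} (stop stopped) u-bound ne s ne′ stc = begin
    score G w s ne′          ≤⟨ u-bound s ne′ stc ⟩
    u                        ≤⟨ Stop⇒u≤[1+ε]l {ε} {l} {u} stopped ⟩
    (1ℚ + ε) * l             ≤⟨ ℚ.*-monoˡ-≤-nonNeg (1ℚ + ε) {{ℚ.nonNegative 0≤1+ε}}
                                  (optimalFor⇒≤score G w l (o l) (exact l) ne) ⟩
    (1ℚ + ε) * score G w (o l) ne ∎
    where open ℚ.≤-Reasoning
  Run⇒ScoreUpperBound (raise _ _ run) u-bound = Run⇒ScoreUpperBound run u-bound
  Run⇒ScoreUpperBound (lower {l} {u} _ empty run) _ =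
    Run⇒ScoreUpperBound run (optimalFor-Empty⇒ScoreUpperBound G w (midpoint l u) _ (exact (midpoint l u)) empty)

proposition5p2 : ∀ {n : ℕ} (G : Graph n) (w ε : ℚ) → 0ℚ ≤ w → w ≤ 1ℚ → 0ℚ < ε →
    (o : Oracle n) → ExactOracle G w o →
    ∀ (r : Solution n) → Run o ε 0ℚ (initialUpper n) r →
    (ne : Nonempty (proj₁ r)) →
    ∀ (α* : ℚ) → IsOptimalScore G w α* →
    α* ≤ (1ℚ + ε) * score G w r ne
proposition5p2 G w ε _ w≤1 0<ε o exact r run ne α* ((s* , ne* , stc* , refl) , _) =
  Run⇒ScoreUpperBound G w exact 0≤1+ε run (λ s ne′ _ → score≤initialUpper G w≤1 s ne′) ne s* ne* stc*
  where
  0≤1+ε : 0ℚ ≤ 1ℚ + ε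
  0≤1+ε = ℚ.+-mono-≤ (ℚ.nonNegative⁻¹ 1ℚ) (ℚ.<⇒≤ 0<ε)
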